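{- Let $H\le G_{d,k}$. Then $\widetilde{\mathfrak X}_{d,k}(H)$ is a simplicial complex (i.e. every cell of $\mathfrak X_{d,k}(H)$ has multiplicity $1$) if and only if $H$ satisfies the intersection property. In particular, if $H$ is normal in $G_{d,k}$, then $\widetilde{\mathfrak X}_{d,k}(H)$ is a simplicial complex if and only if for every $0\le j\le d$ and every $J=\{i_0,\dots,i_j\}\subseteq[\![d]\!]$, $\bigcap_{r=0}^j\mathcal A_{[K_{\widehat{i_r}}]_H}=\mathcal A_{[K_{\widehat J}]_H}$ (that is, the defining identity need only be checked for $g=e$).
   Context: $[\![d]\!]=\{0,\dots,d\}$, $G_{d,k}=\langle\alpha_0,\dots,\alpha_d\mid\alpha_i^k=e\rangle$. For $J\subseteq[\![d]\!]$: $K_J=\langle\alpha_j:j\in J\rangle$, $\widehat J=[\![d]\!]\setminus J$, $\widehat i=\widehat{\{i\}}$. For $H\le G_{d,k}$, right cosets $K_{\widehat J}g,K_{\widehat{J'}}g'$ are equivalent if $\{K_{\widehat J}gh:h\in H\}=\{K_{\widehat{J'}}g'h:h\in H\}$; $[K_{\widehat J}g]_H$ denotes the class and $\mathcal M(H)$ the set of classes. $\Phi([K_{\widehat J}g]_H)=\{[K_{\widehat i}g]_H:i\in J\}$ is well defined and $\mathfrak X_{d,k}(H)=\Phi(\mathcal M(H))$ is a simplicial complex. $\widetilde{\mathfrak X}_{d,k}(H)$ is the multicomplex over $\mathfrak X_{d,k}(H)$ in which the multicells over a cell $\sigma$ are the elements of $\Phi^{ -1}(\sigma)$, so the multiplicity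 of $\sigma$ is $|\Phi^{ -1}(\sigma)|$. For a class $c=[K_{\widehat J}g]_H$ set $\mathcal A_c=\{g'\in G_{d,k}:[K_{\widehat J}g]_H=[K_{\widehat J}g']_H\}$. $H$ satisfies the intersection property if for every $0\le j\le d$, every $J=\{i_0,\dots,i_j\}\subseteq[\![d]\!]$ and every $g\in G_{d,k}$: $\bigcap_{r=0}^j\mathcal A_{[K_{\widehat{i_r}}g]_H}=\mathcal A_{[K_{\widehat J}g]_H}$. -}

module Defs where

open import Data.Nat using (ℕ; suc)
open import Data.Bool using (Bool; true; false; not)
open import Data.Fin using (Fin)
open import Data.Fin.Subset using (Subset; _∈_; ∁; ⁅_⁆; Nonempty)
open import Data.List using (List; []; _∷_; _++_; replicate; reverse; map)
open import Data.List.Relation.Unary.All using (All)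
open import Data.Product using (Σ; ∃; _×_; _,_; proj₁)

-- The group G_{d,k} = ⟨ α_0, …, α_d ∣ α_i^k = e ⟩, given by its
-- presentation: words in the letters α_i^{±1} (i ∈ [[d]] = Fin (suc d);
-- the Bool is true for α_i and false for α_i⁻¹), modulo the congruence
-- generated by free cancellation and the relators α_i^k.

Letter : ℕ → Set
Letter d = Fin (suc d) × Bool

Word : ℕ → Set
Word d = List (Letter d)

data Eq (d k : ℕ) : Word d → Word d → Set where
  eq-refl  : ∀ {u} → Eq d k u u
  eq-sym   : ∀ {u v} → Eq d k u v → Eq d k v u
  eq-trans : ∀ {u v w} → Eq d k u v → Eq d k v w → Eq d k u w
  eq-free  : ∀ u v i b → Eq d k (u ++ (i , b) ∷ (i , not b) ∷ v) (u ++ v)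
  eq-pow   : ∀ u v i → Eq d k (u ++ replicate k (i , true) ++ v) (u ++ v)

-- group operations: product is concatenation, e is the empty word
invLetter : ∀ {d} → Letter d → Letter d
invLetter (i , b) = (i , not b)

inv : ∀ {d} → Word d → Word d
inv w = reverse (map invLetter w)

e : ∀ {d} → Word d
e = []

record Subgroup (d k : ℕ) : Set₁ where
  field
    mem      : Word d → Set
    mem-resp : ∀ {u v} → Eq d k u v → mem u → mem v
    mem-e    : mem e
    mem-mul  : ∀ {u v} → mem u → mem v → mem (u ++ v)
    mem-inv  : ∀ {u} → mem u → mem (inv u)
open Subgroup public

Normal : ∀ {d k} → Subgroup d k → Set
Normal {d} {k} H = ∀ (g h : Word d) → mem H h → mem H (inv g ++ h ++ g)

-- K_S = ⟨ α_j : j ∈ S ⟩ and the right coset K_S g as a subset of G.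

InCoset : ∀ {d} (k : ℕ) → Subset (suc d) → Word d → Word d → Set
InCoset {d} k S g x = Σ (Word d) λ w → All (λ l → proj₁ l ∈ S) w × Eq d k x (w ++ g)

CosetEq : ∀ {d} (k : ℕ) → Subset (suc d) → Word d
        → Subset (suc d) → Word d → Set
CosetEq {d} k S g S' g' =
  ∀ (x : Word d) → (InCoset k S g x → InCoset k S' g' x) × (InCoset k S' g' x → InCoset k S g x)

-- K_{Ĵ} g ~ K_{Ĵ'} g'  iff  { K_{Ĵ} g h : h ∈ H } = { K_{Ĵ'} g' h : h ∈ H }.
-- [K_{Ĵ} g]_H is represented by the pair (J , g).

ClassEq : ∀ {d k} → Subgroup d k → Subset (suc d) → Word d
        → Subset (suc d) → Word d → Set
ClassEq {d} {k} H J g J' g' =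
  (∀ h → mem H h → Σ (Word d) λ h' → mem H h' × CosetEq k (∁ J) (g ++ h) (∁ J') (g' ++ h'))
  × (∀ h' → mem H h' → Σ (Word d) λ h → mem H h × CosetEq k (∁ J) (g ++ h) (∁ J') (g' ++ h'))

-- Φ([K_{Ĵ} g]_H) = { [K_{î} g]_H : i ∈ J }, and equality of two such
-- sets of vertex classes.
ΦEq : ∀ {d k} → Subgroup d k → Subset (suc d) → Word d
    → Subset (suc d) → Word d → Set
ΦEq {d} H J g J' g' =
  (∀ i → i ∈ J → Σ (Fin (suc d)) λ i' → i' ∈ J' × ClassEq H ⁅ i ⁆ g ⁅ i' ⁆ g')
  × (∀ i' → i' ∈ J' → Σ (Fin (suc d)) λ i → i ∈ J × ClassEq H ⁅ i ⁆ g ⁅ i' ⁆ g')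

-- The multicomplex X̃_{d,k}(H) is a simplicial complex: every cell has
-- multiplicity 1, i.e. each fibre Φ⁻¹(σ) has exactly one element,
-- i.e. Φ is injective on M(H).
IsSimplicial : ∀ {d k} → Subgroup d k → Set
IsSimplicial {d} H =
  ∀ (J : Subset (suc d)) (g : Word d) (J' : Subset (suc d)) (g' : Word d)
  → ΦEq H J g J' g' → ClassEq H J g J' g'

InA : ∀ {d k} → Subgroup d k → Subset (suc d) → Word d → Word d → Set
InA H J g g' = ClassEq H J g J g'

IntersectionAt : ∀ {d k} → Subgroup d k → Subset (suc d) → Word d → Set
IntersectionAt {d} H J g =
  ∀ (g' : Word d) → ((∀ i → i ∈ J → InA H ⁅ i ⁆ g g') → InA H J g g')
                  × (InA H J g g' → ∀ i → i ∈ J → InA H ⁅ i ⁆ g g')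

IntersectionProperty : ∀ {d k} → Subgroup d k → Set
IntersectionProperty {d} H =
  ∀ (J : Subset (suc d)) → Nonempty J → ∀ (g : Word d) → IntersectionAt H J g

-- The class [K_Ĵ g]_H is determined by J together with the double coset
-- K_Ĵ g H, and A_[K_Ĵ g]_H is exactly K_Ĵ g H. For k ≠ 1 the type J of a
-- class is well defined: when j ∉ T the exponent sum of α_j modulo k is
-- constant on right cosets of K_T, whereas α_j g and g differ by 1 in it and
-- lie in the same coset of K_T when j ∈ T. Hence two classes with the same
-- image under Φ have the same type J and g' ∈ A_[K_î g] for every i ∈ J; the
-- intersection property says precisely that this forces g' ∈ A_[K_Ĵ g], i.e.
-- that the two classes coincide. For normal H, g' ∈ K_Ĵ g H iff
-- g' g⁻¹ ∈ K_Ĵ H, which reduces the property to g = e.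
module Submission where

open import Defs
open import Data.Bool using (Bool; true; false; not)
open import Data.Bool.Properties using (not-involutive)
open import Data.Fin using (Fin; _≟_)
open import Data.Fin.Subset using (Subset; _∈_; _∉_; _⊆_; ∁; ⁅_⁆; Nonempty; Empty)
open import Data.Fin.Subset.Properties
  using (_∈?_; nonempty?; x∈⁅x⁆; x∈⁅y⁆⇒x≡y; x∉p⇒x∈∁p; p⊆q⇒∁p⊇∁q; ∁p⊆∁q⇒p⊇q; ⊆-antisym)
open import Data.Integer using (ℤ; +_; 0ℤ; 1ℤ; -1ℤ; _+_; _*_; _-_)
open import Data.Integer.Divisibility.Signed using (_∣_; divides; ∣⇒∣ᵤ; ∣m⇒∣-m; ∣m∣n⇒∣m+n)
open import Data.Integer.Properties
  using (+-assoc; +-comm; +-identityˡ; +-identityʳ; *-comm; suc-*; i≡j⇒i-j≡0; +-minus-telescope; +-0-abelianGroup)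
open import Algebra.Properties.AbelianGroup +-0-abelianGroup using (⁻¹-anti-homo‿-; xyx⁻¹≈y)
open import Data.List using ([]; _∷_; _++_; [_]; replicate; reverse; map)
open import Data.List.Properties
  using (++-assoc; ++-identityʳ; unfold-reverse; reverse-map; reverse-involutive; map-∘; map-cong; map-id)
open import Data.List.Relation.Unary.All as All using (All; []; _∷_)
open import Data.List.Relation.Unary.All.Properties using (++⁺)
open import Data.Nat using (ℕ; zero; suc; _≤_)
open import Data.Nat.Divisibility using (∣1⇒≡1)
open import Data.Nat.Properties using (>⇒≢)
open import Data.Product using (Σ; _×_; _,_; proj₁; proj₂)
open import Function using (_∘_)
open import Function.Bundles using (_⇔_; mk⇔; Equivalence)
open import Relation.Binary.Bundles using (Setoid)
open import Relation.Binary.PropositionalEquality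
  using (_≡_; _≢_; refl; sym; trans; cong; cong₂; subst; module ≡-Reasoning)
open import Relation.Nullary using (yes; no; contradiction)

-- The group G_{d,k}

module _ {d : ℕ} where
  open ≡-Reasoning

  inv-∷ : ∀ l (w : Word d) → inv (l ∷ w) ≡ inv w ++ [ invLetter l ]
  inv-∷ l w = unfold-reverse (invLetter l) (map invLetter w)

  invLetter-involutive : ∀ (l : Letter d) → invLetter (invLetter l) ≡ l
  invLetter-involutive (i , b) = cong (i ,_) (not-involutive b)

  inv-involutive : ∀ (w : Word d) → inv (inv w) ≡ w
  inv-involutive w = begin
    reverse (map invLetter (reverse (map invLetter w)))   ≡⟨ cong reverse (reverse-map invLetter (map invLetter w)) ⟩
    reverse (reverse (map invLetter (map invLetter w)))   ≡⟨ reverse-involutive _ ⟩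
    map invLetter (map invLetter w)                       ≡⟨ map-∘ w ⟨
    map (invLetter ∘ invLetter) w                         ≡⟨ map-cong invLetter-involutive w ⟩
    map (λ l → l) w                                       ≡⟨ map-id w ⟩
    w                                                     ∎

module _ {d k : ℕ} where

  private
    infix 4 _≈_
    _≈_ : Word d → Word d → Set
    _≈_ = Eq d k

  word-setoid : Setoid _ _
  word-setoid = record
    { Carrier = Word d ; _≈_ = _≈_
    ; isEquivalence = record { refl = eq-refl ; sym = eq-sym ; trans = eq-trans } }

  open import Relation.Binary.Reasoning.Setoid word-setoid

  ++-congˡ : ∀ a {u v} → u ≈ v → a ++ u ≈ a ++ v
  ++-congˡ a eq-refl         = eq-refl
  ++-congˡ a (eq-sym p)      = eq-sym (++-congˡ a p)
  ++-congˡ a (eq-trans p q)  = eq-trans (++-congˡ a p) (++-congˡ a q)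
  ++-congˡ a (eq-free u v i b) = begin
    a ++ (u ++ (i , b) ∷ (i , not b) ∷ v)   ≡⟨ ++-assoc a u _ ⟨
    (a ++ u) ++ (i , b) ∷ (i , not b) ∷ v   ≈⟨ eq-free (a ++ u) v i b ⟩
    (a ++ u) ++ v                           ≡⟨ ++-assoc a u v ⟩
    a ++ (u ++ v)                           ∎
  ++-congˡ a (eq-pow u v i) = begin
    a ++ (u ++ replicate k (i , true) ++ v)   ≡⟨ ++-assoc a u _ ⟨
    (a ++ u) ++ replicate k (i , true) ++ v   ≈⟨ eq-pow (a ++ u) v i ⟩
    (a ++ u) ++ v                             ≡⟨ ++-assoc a u v ⟩
    a ++ (u ++ v)                             ∎

  ++-congʳ : ∀ a {u v} → u ≈ v → u ++ a ≈ v ++ a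
  ++-congʳ a eq-refl         = eq-refl
  ++-congʳ a (eq-sym p)      = eq-sym (++-congʳ a p)
  ++-congʳ a (eq-trans p q)  = eq-trans (++-congʳ a p) (++-congʳ a q)
  ++-congʳ a (eq-free u v i b) = begin
    (u ++ (i , b) ∷ (i , not b) ∷ v) ++ a   ≡⟨ ++-assoc u _ a ⟩
    u ++ (i , b) ∷ (i , not b) ∷ (v ++ a)   ≈⟨ eq-free u (v ++ a) i b ⟩
    u ++ (v ++ a)                           ≡⟨ ++-assoc u v a ⟨
    (u ++ v) ++ a                           ∎
  ++-congʳ a (eq-pow u v i) = begin
    (u ++ replicate k (i , true) ++ v) ++ a     ≡⟨ ++-assoc u _ a ⟩
    u ++ ((replicate k (i , true) ++ v) ++ a)   ≡⟨ cong (u ++_) (++-assoc (replicate k (i , true)) v a) ⟩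
    u ++ replicate k (i , true) ++ (v ++ a)     ≈⟨ eq-pow u (v ++ a) i ⟩
    u ++ (v ++ a)                               ≡⟨ ++-assoc u v a ⟨
    (u ++ v) ++ a                               ∎

  ++-inverseʳ : ∀ (w : Word d) → w ++ inv w ≈ e
  ++-inverseʳ []            = eq-refl
  ++-inverseʳ ((i , b) ∷ w) = begin
    (i , b) ∷ (w ++ inv ((i , b) ∷ w))            ≡⟨ cong (λ z → (i , b) ∷ (w ++ z)) (inv-∷ (i , b) w) ⟩
    (i , b) ∷ (w ++ (inv w ++ [ (i , not b) ]))   ≡⟨ cong ((i , b) ∷_) (++-assoc w (inv w) _) ⟨
    (i , b) ∷ ((w ++ inv w) ++ [ (i , not b) ])   ≈⟨ ++-congˡ [ (i , b) ] (++-congʳ _ (++-inverseʳ w)) ⟩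
    (i , b) ∷ (i , not b) ∷ []                    ≈⟨ eq-free [] [] i b ⟩
    e                                             ∎

  ++-inverseˡ : ∀ (w : Word d) → inv w ++ w ≈ e
  ++-inverseˡ w = subst (λ v → inv w ++ v ≈ e) (inv-involutive w) (++-inverseʳ (inv w))

  ++-cancelˡ : ∀ {u v} x → u ++ v ≈ e → u ++ (v ++ x) ≈ x
  ++-cancelˡ {u} {v} x uv≈e = begin
    u ++ (v ++ x)   ≡⟨ ++-assoc u v x ⟨
    (u ++ v) ++ x   ≈⟨ ++-congʳ x uv≈e ⟩
    x               ∎

  ++-cancelʳ : ∀ {u v} x → u ++ v ≈ e → (x ++ u) ++ v ≈ x
  ++-cancelʳ {u} {v} x uv≈e = begin
    (x ++ u) ++ v   ≡⟨ ++-assoc x u v ⟩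
    x ++ (u ++ v)   ≈⟨ ++-congˡ x uv≈e ⟩
    x ++ []         ≡⟨ ++-identityʳ x ⟩
    x               ∎

-- Right cosets K_T g

InK : ∀ {d} → Subset (suc d) → Word d → Set
InK T w = All (λ l → proj₁ l ∈ T) w

module _ {d k : ℕ} {T : Subset (suc d)} where

  private
    infix 4 _≈_
    _≈_ : Word d → Word d → Set
    _≈_ = Eq d k

  open import Relation.Binary.Reasoning.Setoid (word-setoid {d} {k})

  InK-inv : ∀ {w} → InK T w → InK T (inv w)
  InK-inv {[]}    []       = []
  InK-inv {l ∷ w} (p ∷ ps) = subst (InK T) (sym (inv-∷ l w)) (++⁺ (InK-inv ps) (p ∷ []))

  InCoset-refl : ∀ {g} → InCoset k T g g
  InCoset-refl = [] , [] , eq-refl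

  InCoset-sym : ∀ {g x} → InCoset k T g x → InCoset k T x g
  InCoset-sym {g} {x} (w , w∈K , x≈wg) = inv w , InK-inv w∈K , (begin
    g                 ≈⟨ ++-cancelˡ {u = inv w} g (++-inverseˡ w) ⟨
    inv w ++ (w ++ g) ≈⟨ ++-congˡ (inv w) x≈wg ⟨
    inv w ++ x        ∎)

  InCoset-trans : ∀ {g x y} → InCoset k T g x → InCoset k T x y → InCoset k T g y
  InCoset-trans {g} {x} {y} (w , w∈K , x≈wg) (w′ , w′∈K , y≈w′x) = w′ ++ w , ++⁺ w′∈K w∈K , (begin
    y               ≈⟨ y≈w′x ⟩
    w′ ++ x         ≈⟨ ++-congˡ w′ x≈wg ⟩
    w′ ++ (w ++ g)  ≡⟨ ++-assoc w′ w g ⟨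
    (w′ ++ w) ++ g  ∎)

  InCoset-respˡ : ∀ {g g′ x} → g ≈ g′ → InCoset k T g x → InCoset k T g′ x
  InCoset-respˡ g≈g′ (w , w∈K , x≈wg) = w , w∈K , eq-trans x≈wg (++-congˡ w g≈g′)

  InCoset-respʳ : ∀ {g x x′} → x ≈ x′ → InCoset k T g x → InCoset k T g x′
  InCoset-respʳ x≈x′ (w , w∈K , x≈wg) = w , w∈K , eq-trans (eq-sym x≈x′) x≈wg

  InCoset-∙ʳ : ∀ {g x} a → InCoset k T g x → InCoset k T (g ++ a) (x ++ a)
  InCoset-∙ʳ {g} {x} a (w , w∈K , x≈wg) = w , w∈K , (begin
    x ++ a         ≈⟨ ++-congʳ a x≈wg ⟩
    (w ++ g) ++ a  ≡⟨ ++-assoc w g a ⟩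
    w ++ (g ++ a)  ∎)

  InCoset⇒CosetEq : ∀ {x y} → InCoset k T y x → CosetEq k T x T y
  InCoset⇒CosetEq x∈Ky _ = InCoset-trans x∈Ky , InCoset-trans (InCoset-sym x∈Ky)

InCoset-mono : ∀ {d k} {T T′ : Subset (suc d)} {g x} → T ⊆ T′ → InCoset k T g x → InCoset k T′ g x
InCoset-mono T⊆T′ (w , w∈K , x≈wg) = w , All.map T⊆T′ w∈K , x≈wg

CosetEq⇒InCoset : ∀ {d k} {T T′ : Subset (suc d)} {x y} → CosetEq k T x T′ y → InCoset k T′ y x
CosetEq⇒InCoset {x = x} ce = proj₁ (ce x) InCoset-refl

CosetEq-sym : ∀ {d k} {T T′ : Subset (suc d)} {x y} → CosetEq k T x T′ y → CosetEq k T′ y T x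
CosetEq-sym ce z = proj₂ (ce z) , proj₁ (ce z)

-- Exponent sums modulo k

sign : Bool → ℤ
sign true  = 1ℤ
sign false = -1ℤ

sign-cancel : ∀ b → sign b + sign (not b) ≡ 0ℤ
sign-cancel true  = refl
sign-cancel false = refl

module _ {d : ℕ} (j : Fin (suc d)) where
  open ≡-Reasoning

  exponent : Letter d → ℤ
  exponent (i , b) with i ≟ j
  ... | yes _ = sign b
  ... | no  _ = 0ℤ

  exponentSum : Word d → ℤ
  exponentSum []      = 0ℤ
  exponentSum (l ∷ w) = exponent l + exponentSum w

  exponent-self : exponent (j , true) ≡ 1ℤ
  exponent-self with j ≟ j
  ... | yes _   = refl
  ... | no  j≢j = contradiction refl j≢j

  exponent-≢ : ∀ {i} b → i ≢ j → exponent (i , b) ≡ 0ℤ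
  exponent-≢ {i} b i≢j with i ≟ j
  ... | yes i≡j = contradiction i≡j i≢j
  ... | no  _   = refl

  exponent-cancel : ∀ i b → exponent (i , b) + exponent (i , not b) ≡ 0ℤ
  exponent-cancel i b with i ≟ j
  ... | yes _ = sign-cancel b
  ... | no  _ = refl

  exponentSum-++ : ∀ u v → exponentSum (u ++ v) ≡ exponentSum u + exponentSum v
  exponentSum-++ []      v = sym (+-identityˡ (exponentSum v))
  exponentSum-++ (l ∷ u) v = begin
    exponent l + exponentSum (u ++ v)                ≡⟨ cong (λ s → exponent l + s) (exponentSum-++ u v) ⟩
    exponent l + (exponentSum u + exponentSum v)     ≡⟨ +-assoc (exponent l) _ _ ⟨
    exponent l + exponentSum u + exponentSum v       ∎

  exponentSum-replicate : ∀ n l → exponentSum (replicate n l) ≡ + n * exponent l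
  exponentSum-replicate zero    l = refl
  exponentSum-replicate (suc n) l = begin
    exponent l + exponentSum (replicate n l)   ≡⟨ cong (λ s → exponent l + s) (exponentSum-replicate n l) ⟩
    exponent l + + n * exponent l              ≡⟨ suc-* (+ n) (exponent l) ⟨
    + suc n * exponent l                       ∎

  exponentSum-insert : ∀ u x v → exponentSum (u ++ x ++ v) - exponentSum (u ++ v) ≡ exponentSum x
  exponentSum-insert u x v = begin
    σ (u ++ x ++ v) - σ (u ++ v)        ≡⟨ cong₂ _-_ (exponentSum-++ u (x ++ v)) (exponentSum-++ u v) ⟩
    σ u + σ (x ++ v) - (σ u + σ v)      ≡⟨ cong (λ s → σ u + s - (σ u + σ v)) (exponentSum-++ x v) ⟩
    σ u + (σ x + σ v) - (σ u + σ v)     ≡⟨ cong (λ s → σ u + s - (σ u + σ v)) (+-comm (σ x) (σ v)) ⟩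
    σ u + (σ v + σ x) - (σ u + σ v)     ≡⟨ cong (_- (σ u + σ v)) (+-assoc (σ u) (σ v) (σ x)) ⟨
    σ u + σ v + σ x - (σ u + σ v)       ≡⟨ xyx⁻¹≈y (σ u + σ v) (σ x) ⟩
    σ x                                 ∎
    where
    σ : Word d → ℤ
    σ = exponentSum

  exponentSum-resp : ∀ {k u v} → Eq d k u v → + k ∣ exponentSum u - exponentSum v
  exponentSum-resp {u = u} eq-refl = divides 0ℤ (i≡j⇒i-j≡0 {exponentSum u} refl)
  exponentSum-resp {k} {u} {v} (eq-sym p) =
    subst (+ k ∣_) (⁻¹-anti-homo‿- (exponentSum v) (exponentSum u)) (∣m⇒∣-m (exponentSum-resp p))
  exponentSum-resp {k} {u} {w} (eq-trans {v = v} p q) =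
    subst (+ k ∣_) (+-minus-telescope (exponentSum u) (exponentSum v) (exponentSum w))
      (∣m∣n⇒∣m+n (exponentSum-resp p) (exponentSum-resp q))
  exponentSum-resp (eq-free u v i b) = divides 0ℤ (begin
    exponentSum (u ++ (i , b) ∷ (i , not b) ∷ v) - exponentSum (u ++ v)  ≡⟨ exponentSum-insert u _ v ⟩
    exponent (i , b) + (exponent (i , not b) + 0ℤ)                        ≡⟨ +-assoc (exponent (i , b)) (exponent (i , not b)) 0ℤ ⟨
    exponent (i , b) + exponent (i , not b) + 0ℤ                          ≡⟨ +-identityʳ _ ⟩
    exponent (i , b) + exponent (i , not b)                               ≡⟨ exponent-cancel i b ⟩
    0ℤ                                                                    ∎)
  exponentSum-resp {k} (eq-pow u v i) = divides (exponent (i , true)) (begin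
    exponentSum (u ++ replicate k (i , true) ++ v) - exponentSum (u ++ v)  ≡⟨ exponentSum-insert u _ v ⟩
    exponentSum (replicate k (i , true))                                   ≡⟨ exponentSum-replicate k _ ⟩
    + k * exponent (i , true)                                              ≡⟨ *-comm (+ k) _ ⟩
    exponent (i , true) * + k                                              ∎)

  exponentSum-InK : ∀ {T w} → j ∉ T → InK T w → exponentSum w ≡ 0ℤ
  exponentSum-InK j∉T []                   = refl
  exponentSum-InK {T} j∉T (_∷_ {x = i , b} i∈T w∈K) =
    cong₂ _+_ (exponent-≢ b (λ i≡j → j∉T (subst (_∈ T) i≡j i∈T))) (exponentSum-InK j∉T w∈K)

  exponentSum-InCoset : ∀ {k T g x} → j ∉ T → InCoset k T g x → + k ∣ exponentSum x - exponentSum g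
  exponentSum-InCoset {k} {g = g} {x} j∉T (w , w∈K , x≈wg) =
    subst (λ s → + k ∣ exponentSum x - s) σ[wg]≡σg (exponentSum-resp x≈wg)
    where
    σ[wg]≡σg : exponentSum (w ++ g) ≡ exponentSum g
    σ[wg]≡σg = begin
      exponentSum (w ++ g)              ≡⟨ exponentSum-++ w g ⟩
      exponentSum w + exponentSum g     ≡⟨ cong (_+ exponentSum g) (exponentSum-InK j∉T w∈K) ⟩
      0ℤ + exponentSum g                ≡⟨ +-identityˡ (exponentSum g) ⟩
      exponentSum g                     ∎

CosetEq⇒⊆ : ∀ {d k} {T T′ : Subset (suc d)} {x y} → k ≢ 1 → CosetEq k T x T′ y → T ⊆ T′
CosetEq⇒⊆ {k = k} {T′ = T′} {x} k≢1 ce {j} j∈T with j ∈? T′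
... | yes j∈T′ = j∈T′
... | no  j∉T′ = contradiction (∣1⇒≡1 (∣⇒∣ᵤ k∣1)) k≢1
  where
  αx∈K[x] : InCoset k T′ x ((j , true) ∷ x)
  αx∈K[x] = InCoset-trans (InCoset-sym (CosetEq⇒InCoset ce)) (proj₁ (ce _) ([ (j , true) ] , j∈T ∷ [] , eq-refl))
  k∣1 : + k ∣ 1ℤ
  k∣1 = subst (+ k ∣_) σ[αx]-σx≡1 (exponentSum-InCoset j j∉T′ αx∈K[x])
    where
    σ[αx]-σx≡1 : exponentSum j ((j , true) ∷ x) - exponentSum j x ≡ 1ℤ
    σ[αx]-σx≡1 = begin
      exponent j (j , true) + σx - σx   ≡⟨ cong (λ s → s + σx - σx) (exponent-self j) ⟩
      1ℤ + σx - σx                      ≡⟨ cong (_- σx) (+-comm 1ℤ σx) ⟩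
      σx + 1ℤ - σx                      ≡⟨ xyx⁻¹≈y σx 1ℤ ⟩
      1ℤ                                ∎
      where
      open ≡-Reasoning
      σx : ℤ
      σx = exponentSum j x

-- Double cosets K_T g H and the sets A_c

module _ {d k : ℕ} (H : Subgroup d k) where

  open import Relation.Binary.Reasoning.Setoid (word-setoid {d} {k})

  InDoubleCoset : Subset (suc d) → Word d → Word d → Set
  InDoubleCoset T g x = Σ (Word d) λ h → mem H h × InCoset k T (g ++ h) x

  InA⇒InDoubleCoset : ∀ {J g x} → InA H J g x → InDoubleCoset (∁ J) g x
  InA⇒InDoubleCoset {J} {g} {x} (same-cosets , _) with same-cosets e (mem-e H)
  ... | h , h∈H , ce = inv h , mem-inv H h∈H ,
    InCoset-respʳ (++-cancelʳ x (++-inverseʳ h))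
      (subst (λ y → InCoset k (∁ J) (y ++ inv h) _) (++-identityʳ g)
        (InCoset-∙ʳ (inv h) (InCoset-sym (CosetEq⇒InCoset ce))))

  InDoubleCoset⇒InA : ∀ {J g x} → InDoubleCoset (∁ J) g x → InA H J g x
  InDoubleCoset⇒InA {J} {g} {x} (h , h∈H , x∈KghH) =
      (λ h₁ h₁∈H → inv h ++ h₁ , mem-mul H (mem-inv H h∈H) h₁∈H ,
        CosetEq-sym (InCoset⇒CosetEq (subst (InCoset k (∁ J) (g ++ h₁)) (++-assoc x (inv h) h₁)
          (InCoset-∙ʳ h₁ (InCoset-respˡ (++-cancelʳ g (++-inverseʳ h)) (InCoset-∙ʳ (inv h) x∈KghH))))))
    , (λ h′ h′∈H → h ++ h′ , mem-mul H h∈H h′∈H ,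
        CosetEq-sym (InCoset⇒CosetEq (subst (λ y → InCoset k (∁ J) y (x ++ h′)) (++-assoc g h h′)
          (InCoset-∙ʳ h′ x∈KghH))))

  InA-antitone : ∀ {J J′ g x} → J′ ⊆ J → InA H J g x → InA H J′ g x
  InA-antitone J′⊆J a with InA⇒InDoubleCoset a
  ... | h , h∈H , x∈KghH = InDoubleCoset⇒InA (h , h∈H , InCoset-mono (p⊆q⇒∁p⊇∁q J′⊆J) x∈KghH)

  InA-restrict : ∀ {J g x} → InA H J g x → ∀ i → i ∈ J → InA H ⁅ i ⁆ g x
  InA-restrict {J} a i i∈J = InA-antitone ⁅i⁆⊆J a
    where
    ⁅i⁆⊆J : ⁅ i ⁆ ⊆ J
    ⁅i⁆⊆J i′∈⁅i⁆ = subst (_∈ J) (sym (x∈⁅y⁆⇒x≡y i i′∈⁅i⁆)) i∈J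

  InA-Empty : ∀ {J} → Empty J → ∀ g x → InA H J g x
  InA-Empty {J} J-empty g x = InDoubleCoset⇒InA (e , mem-e H , x ++ inv g , everything-in-K , (begin
    x                          ≈⟨ ++-cancelʳ x (++-inverseˡ g) ⟨
    (x ++ inv g) ++ g          ≡⟨ cong ((x ++ inv g) ++_) (++-identityʳ g) ⟨
    (x ++ inv g) ++ (g ++ e)   ∎))
    where
    everything-in-K : InK (∁ J) (x ++ inv g)
    everything-in-K = All.universal (λ _ → x∉p⇒x∈∁p (λ i∈J → J-empty (_ , i∈J))) _

  InDoubleCoset-translate : Normal H → ∀ {T g x} → InDoubleCoset T g x → InDoubleCoset T e (x ++ inv g)
  InDoubleCoset-translate normal {T} {g} {x} (h , h∈H , x∈KghH) =
    inv (inv g) ++ h ++ inv g , normal (inv g) h h∈H ,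
    subst (λ y → InCoset k T y (x ++ inv g)) [gh]g⁻¹≡ (InCoset-∙ʳ (inv g) x∈KghH)
    where
    [gh]g⁻¹≡ : (g ++ h) ++ inv g ≡ inv (inv g) ++ h ++ inv g
    [gh]g⁻¹≡ = trans (++-assoc g h (inv g)) (cong (_++ h ++ inv g) (sym (inv-involutive g)))

  InDoubleCoset-untranslate : Normal H → ∀ {T g x} → InDoubleCoset T e (x ++ inv g) → InDoubleCoset T g x
  InDoubleCoset-untranslate normal {T} {g} {x} (h , h∈H , xg⁻¹∈KhH) =
    inv g ++ h ++ g , normal g h h∈H ,
    InCoset-respˡ (eq-sym (++-cancelˡ {u = g} (h ++ g) (++-inverseʳ g)))
      (InCoset-respʳ (++-cancelʳ x (++-inverseˡ g)) (InCoset-∙ʳ g xg⁻¹∈KhH))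

  InA-translate : Normal H → ∀ {J g x} → InA H J g x ⇔ InA H J e (x ++ inv g)
  InA-translate normal = mk⇔
    (InDoubleCoset⇒InA ∘ InDoubleCoset-translate normal ∘ InA⇒InDoubleCoset)
    (InDoubleCoset⇒InA ∘ InDoubleCoset-untranslate normal ∘ InA⇒InDoubleCoset)

-- The type of a class

module _ {d k : ℕ} (H : Subgroup d k) (k≢1 : k ≢ 1) where

  ClassEq⇒≡ : ∀ {J g J′ g′} → ClassEq H J g J′ g′ → J ≡ J′
  ClassEq⇒≡ (same-cosets , _) with same-cosets e (mem-e H)
  ... | _ , _ , ce = ⊆-antisym (∁p⊆∁q⇒p⊇q (CosetEq⇒⊆ k≢1 (CosetEq-sym ce))) (∁p⊆∁q⇒p⊇q (CosetEq⇒⊆ k≢1 ce))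

  ClassEq-vertex⇒≡ : ∀ {i g i′ g′} → ClassEq H ⁅ i ⁆ g ⁅ i′ ⁆ g′ → i ≡ i′
  ClassEq-vertex⇒≡ {i} {i′ = i′} c = x∈⁅y⁆⇒x≡y i′ (subst (i ∈_) (ClassEq⇒≡ c) (x∈⁅x⁆ i))

  ΦEq⇒≡ : ∀ {J g J′ g′} → ΦEq H J g J′ g′ → J ≡ J′
  ΦEq⇒≡ {J} {J′ = J′} (vertices⊆ , vertices⊇) = ⊆-antisym J⊆J′ J′⊆J
    where
    J⊆J′ : J ⊆ J′
    J⊆J′ {i} i∈J with vertices⊆ i i∈J
    ... | i′ , i′∈J′ , c = subst (_∈ J′) (sym (ClassEq-vertex⇒≡ c)) i′∈J′
    J′⊆J : J′ ⊆ J
    J′⊆J {i′} i′∈J′ with vertices⊇ i′ i′∈J′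
    ... | i , i∈J , c = subst (_∈ J) (ClassEq-vertex⇒≡ c) i∈J

  ΦEq⇒InA-vertices : ∀ {J g J′ g′} → ΦEq H J g J′ g′ → ∀ i → i ∈ J → InA H ⁅ i ⁆ g g′
  ΦEq⇒InA-vertices {g = g} {g′ = g′} (vertices⊆ , _) i i∈J with vertices⊆ i i∈J
  ... | i′ , _ , c = subst (λ z → ClassEq H ⁅ i ⁆ g ⁅ z ⁆ g′) (sym (ClassEq-vertex⇒≡ c)) c

  intersection⇒simplicial : IntersectionProperty H → IsSimplicial H
  intersection⇒simplicial intersection J g J′ g′ φ =
    subst (λ J″ → ClassEq H J g J″ g′) (ΦEq⇒≡ φ) g′∈A
    where
    g′∈A : InA H J g g′
    g′∈A with nonempty? J
    ... | yes J-nonempty = proj₁ (intersection J J-nonempty g g′) (ΦEq⇒InA-vertices φ)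
    ... | no  J-empty    = InA-Empty H J-empty g g′

simplicial⇒intersection : ∀ {d k} (H : Subgroup d k) → IsSimplicial H → IntersectionProperty H
simplicial⇒intersection H simplicial J _ g g′ =
    (λ g′∈A-vertices → simplicial J g J g′ ((λ i i∈J → i , i∈J , g′∈A-vertices i i∈J)
                                          , (λ i i∈J → i , i∈J , g′∈A-vertices i i∈J)))
  , (λ g′∈A → InA-restrict H g′∈A)

IntersectionAt-translate : ∀ {d k} (H : Subgroup d k) → Normal H
  → ∀ {J} → IntersectionAt H J e → ∀ g → IntersectionAt H J g
IntersectionAt-translate H normal at-e g g′ =
    (λ g′∈A-vertices → Equivalence.from (InA-translate H normal)
        (proj₁ (at-e (g′ ++ inv g)) (λ i i∈J → Equivalence.to (InA-translate H normal) (g′∈A-vertices i i∈J))))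
  , (λ g′∈A → InA-restrict H g′∈A)

proposition9p5 : (d k : ℕ) → 2 ≤ k → (H : Subgroup d k)
    → (IsSimplicial H ⇔ IntersectionProperty H)
      × (Normal H → (IsSimplicial H ⇔ (∀ (J : Subset (suc d)) → Nonempty J → IntersectionAt H J e)))
proposition9p5 d k 2≤k H =
    mk⇔ (simplicial⇒intersection H) (intersection⇒simplicial H k≢1)
  , λ normal → mk⇔
      (λ simplicial J J-nonempty → simplicial⇒intersection H simplicial J J-nonempty e)
      (λ at-e → intersection⇒simplicial H k≢1 (λ J J-nonempty → IntersectionAt-translate H normal (at-e J J-nonempty)))
  where
  k≢1 : k ≢ 1
  k≢1 = >⇒≢ 2≤k
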